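{- Let $j,k\geq 1$ be integers with $k<j$. Then there is no $X\in2^\omega$ and constant $d$ such that $K^{(k)}(X\upharpoonright n)\geq \ell_j(X\upharpoonright n)-d$ for all $n\in\omega$; i.e., there are no $(k,j)$-incompressible sequences.
   Context: $X\upharpoonright n$ is the first $n$ bits of $X$; $\#_0,\#_1$ count 0's and 1's; $\ell_k(\sigma)=\#_0(\sigma)+k\,\#_1(\sigma)$. Fix a computable listing $(M_e)$ of prefix-free machines and the universal prefix-free machine $U(0^e1\sigma)=M_e(\sigma)$; $K^{(k)}(\sigma)=\min\{\ell_k(\tau):U(\tau)\downarrow=\sigma\}$. -}

module Defs where

open import Data.Nat using (ℕ; zero; suc; _+_; _*_; _≤_; _<_)
open import Data.Fin using (Fin)
open import Data.Vec using (Vec; []; _∷_; lookup)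
open import Data.Bool using (Bool; true; false)
open import Data.List using (List; []; _∷_; _++_; replicate; applyUpTo)
open import Data.Product using (Σ; ∃; _×_; _,_)
open import Function.Bundles using (_⇔_)
open import Relation.Binary.PropositionalEquality using (_≡_)

data Code : ℕ → Set where
  zer  : ∀ {n} → Code n
  succ : Code 1
  proj : ∀ {n} → Fin n → Code n
  comp : ∀ {m n} → Code m → Vec (Code n) m → Code n
  prim : ∀ {n} → Code n → Code (suc (suc n)) → Code (suc n)
  mu   : ∀ {n} → Code (suc n) → Code n

mutual
  data Eval : ∀ {n} → Code n → Vec ℕ n → ℕ → Set where
    ev-zer  : ∀ {n} {xs : Vec ℕ n} → Eval zer xs 0
    ev-succ : ∀ {x} → Eval succ (x ∷ []) (suc x)
    ev-proj : ∀ {n} {i : Fin n} {xs} → Eval (proj i) xs (lookup xs i)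
    ev-comp : ∀ {m n} {f : Code m} {gs : Vec (Code n) m} {xs ys y} →
              EvalAll gs xs ys → Eval f ys y → Eval (comp f gs) xs y
    ev-prim0 : ∀ {n} {f : Code n} {g} {xs y} →
               Eval f xs y → Eval (prim f g) (0 ∷ xs) y
    ev-primS : ∀ {n} {f : Code n} {g} {xs x r y} →
               Eval (prim f g) (x ∷ xs) r → Eval g (x ∷ r ∷ xs) y →
               Eval (prim f g) (suc x ∷ xs) y
    ev-mu   : ∀ {n} {f : Code (suc n)} {xs y} →
              Eval f (y ∷ xs) 0 →
              (∀ z → z < y → Σ ℕ λ w → Eval f (z ∷ xs) (suc w)) →
              Eval (mu f) xs y

  data EvalAll : ∀ {m n} → Vec (Code n) m → Vec ℕ n → Vec ℕ m → Set where
    ev-[] : ∀ {n} {xs : Vec ℕ n} → EvalAll [] xs []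
    ev-∷  : ∀ {m n} {g : Code n} {gs : Vec (Code n) m} {xs y ys} →
            Eval g xs y → EvalAll gs xs ys → EvalAll (g ∷ gs) xs (y ∷ ys)

-- Binary strings (false = 0, true = 1) and their coding into ℕ
-- (bijective base-2 numeration).

Str : Set
Str = List Bool

enc : Str → ℕ
enc []          = 0
enc (false ∷ s) = 1 + 2 * enc s
enc (true  ∷ s) = 2 + 2 * enc s

_↾_ : (ℕ → Bool) → ℕ → Str
X ↾ n = applyUpTo X n

#₀ : Str → ℕ
#₀ []          = 0
#₀ (false ∷ s) = suc (#₀ s)
#₀ (true  ∷ s) = #₀ s

#₁ : Str → ℕ
#₁ []          = 0
#₁ (false ∷ s) = #₁ s
#₁ (true  ∷ s) = suc (#₁ s)

ℓ : ℕ → Str → ℕ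
ℓ k σ = #₀ σ + k * #₁ σ

-- Machines (partial maps Str ⇀ Str) given by their graphs.

Machine : Set₁
Machine = Str → Str → Set

_⊑_ : Str → Str → Set
σ ⊑ τ = Σ Str λ ρ → τ ≡ σ ++ ρ

PrefixFree : Machine → Set
PrefixFree M = ∀ {σ σ' τ τ'} → M σ τ → M σ' τ' → σ ⊑ σ' → σ ≡ σ'

MachineOf : Code 1 → Machine
MachineOf c σ τ = Eval c (enc σ ∷ []) (enc τ)

record PFListing (M : ℕ → Machine) : Set where
  field
    uniform    : Σ (Code 2) λ c → ∀ e σ τ → M e σ τ ⇔ Eval c (e ∷ enc σ ∷ []) (enc τ)
    prefixFree : ∀ e → PrefixFree (M e)
    complete   : ∀ (c : Code 1) → PrefixFree (MachineOf c) →
                 Σ ℕ λ e → ∀ σ τ → M e σ τ ⇔ MachineOf c σ τ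

U : (ℕ → Machine) → Machine
U M τ σ = Σ ℕ λ e → Σ Str λ ρ → (τ ≡ replicate e false ++ (true ∷ ρ)) × M e ρ σ

-- "K^(k)(σ) + d ≥ m", unfolding K^(k)(σ) = min{ ℓ_k(τ) : U(τ)↓ = σ }
-- (min ∅ = ∞, so the bound holds vacuously then).
K≥ : (ℕ → Machine) → ℕ → Str → ℕ → ℕ → Set
K≥ M k σ d m = ∀ τ → U M τ σ → m ≤ ℓ k τ + d

-- If X is eventually 0, say X = σ0^ω, the prefix-free machine 0ʰ1 ↦ σ0²ʰ with index e
-- describes the prefix σ0²ʰ at ℓₖ-cost e + k + h + k, although ℓⱼ(σ0²ʰ) ≥ 2h.
-- Otherwise X has prefixes π ending in a 1 with exactly 2h ones for every h; the machine
-- 0ʰ1π ↦ π, defined exactly on those π, is prefix-free (a proper extension of such a π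
-- ending in 1 has more ones) and describes π at cost e + k + h + k + ℓₖ(π), although
-- ℓⱼ(π) ≥ ℓₖ(π) + #₁(π) = ℓₖ(π) + 2h.  Taking h = e + 2k + d + 1 contradicts
-- K⁽ᵏ⁾(X ↾ n) ≥ ℓⱼ(X ↾ n) − d in either case.  Both machines are written as μ-recursive
-- codes, and the case distinction is made under a double negation.
module Submission where

open import Defs
open import Data.Bool using (Bool; true; false)
open import Data.Bool.Properties using (¬-not)
open import Data.Empty using (⊥-elim)
open import Data.Fin using (Fin)
open import Data.List using (List; []; _∷_; _++_; _∷ʳ_; replicate; drop; take; length)
open import Data.List.Properties
  using (++-assoc; ++-identityʳ; ++-cancelˡ; ∷-injectiveʳ; ∷ʳ-injective; take++drop≡id; drop-drop;
         applyUpTo-∷ʳ)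
open import Data.List.Reverse using (reverseView; []; _∶_∶ʳ_)
open import Data.Nat using (ℕ; zero; suc; _+_; _*_; _∸_; _≤_; _<_; z≤n; s≤s; pred; ∣_-_∣)
open import Data.Nat.Properties
open import Data.Nat.Tactic.RingSolver using (solve-∀)
open import Data.Product using (Σ; _×_; _,_; proj₁; proj₂)
open import Data.Sum using (inj₁; inj₂)
open import Data.Vec using (Vec; []; _∷_; lookup)
open import Effect.Monad using (RawMonad)
open import Function using (_∘_)
open import Function.Bundles using (Equivalence)
open import Level using (0ℓ)
open import Relation.Binary.Definitions using (tri<; tri≈; tri>)
open import Relation.Binary.PropositionalEquality
open import Relation.Nullary using (¬_; yes; no)
open import Relation.Nullary.Negation using (¬¬-Monad)

-- μ-recursive codes

mutual
  Eval-deterministic : ∀ {n} {c : Code n} {xs y y′} → Eval c xs y → Eval c xs y′ → y ≡ y′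
  Eval-deterministic ev-zer ev-zer = refl
  Eval-deterministic ev-succ ev-succ = refl
  Eval-deterministic ev-proj ev-proj = refl
  Eval-deterministic (ev-comp gs f) (ev-comp gs′ f′)
    rewrite EvalAll-deterministic gs gs′ = Eval-deterministic f f′
  Eval-deterministic (ev-prim0 f) (ev-prim0 f′) = Eval-deterministic f f′
  Eval-deterministic (ev-primS r g) (ev-primS r′ g′)
    rewrite Eval-deterministic r r′ = Eval-deterministic g g′
  Eval-deterministic (ev-mu {y = y} zero-at below) (ev-mu {y = y′} zero-at′ below′)
    with <-cmp y y′
  ... | tri≈ _ y≡y′ _ = y≡y′
  ... | tri< y<y′ _ _ with () ← Eval-deterministic zero-at (proj₂ (below′ y y<y′))
  ... | tri> _ _ y′<y with () ← Eval-deterministic zero-at′ (proj₂ (below y′ y′<y))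

  EvalAll-deterministic : ∀ {m n} {gs : Vec (Code n) m} {xs ys ys′} →
                          EvalAll gs xs ys → EvalAll gs xs ys′ → ys ≡ ys′
  EvalAll-deterministic ev-[] ev-[] = refl
  EvalAll-deterministic (ev-∷ g gs) (ev-∷ g′ gs′) =
    cong₂ _∷_ (Eval-deterministic g g′) (EvalAll-deterministic gs gs′)

Computes : ∀ {n} → Code n → (Vec ℕ n → ℕ) → Set
Computes c F = ∀ xs → Eval c xs (F xs)

arg₀ : ∀ {n} → Code (suc n)
arg₀ = proj Fin.zero

arg₁ : ∀ {n} → Code (suc (suc n))
arg₁ = proj (Fin.suc Fin.zero)

arg₂ : ∀ {n} → Code (suc (suc (suc n)))
arg₂ = proj (Fin.suc (Fin.suc Fin.zero))

zer-correct : ∀ {n} → Computes (zer {n}) (λ _ → 0)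
zer-correct _ = ev-zer

proj-correct : ∀ {n} {i : Fin n} → Computes (proj i) (λ xs → lookup xs i)
proj-correct _ = ev-proj

succ-correct : Computes succ (λ { (n ∷ []) → suc n })
succ-correct (n ∷ []) = ev-succ

compose₁ : ∀ {n} {f : Code 1} {g : Code n} {F G} → Computes f F → Computes g G →
           Computes (comp f (g ∷ [])) (λ xs → F (G xs ∷ []))
compose₁ f g xs = ev-comp (ev-∷ (g xs) ev-[]) (f _)

compose₂ : ∀ {n} {f : Code 2} {g h : Code n} {F G H} → Computes f F → Computes g G → Computes h H →
           Computes (comp f (g ∷ h ∷ [])) (λ xs → F (G xs ∷ H xs ∷ []))
compose₂ f g h xs = ev-comp (ev-∷ (g xs) (ev-∷ (h xs) ev-[])) (f _)

prim-computes : ∀ {n} {f : Code n} {g : Code (suc (suc n))} {F G} (H : Vec ℕ (suc n) → ℕ) →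
                Computes f F → Computes g G →
                (∀ xs → H (0 ∷ xs) ≡ F xs) →
                (∀ x xs → H (suc x ∷ xs) ≡ G (x ∷ H (x ∷ xs) ∷ xs)) →
                Computes (prim f g) H
prim-computes H f g base step (zero ∷ xs) =
  subst (Eval _ _) (sym (base xs)) (ev-prim0 (f xs))
prim-computes H f g base step (suc x ∷ xs) =
  subst (Eval _ _) (sym (step x xs)) (ev-primS (prim-computes H f g base step (x ∷ xs)) (g _))

MinimalZero : (ℕ → ℕ) → ℕ → Set
MinimalZero f y = f y ≡ 0 × (∀ z → z < y → Σ ℕ λ w → f z ≡ suc w)

minimalZero : (f : ℕ → ℕ) (z : ℕ) → f z ≡ 0 → Σ ℕ (MinimalZero f)
minimalZero f zero fz≡0 = 0 , fz≡0 , λ _ ()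
minimalZero f (suc z) fz≡0 with f 0 in f0
... | zero = 0 , f0 , λ _ ()
... | suc w with minimalZero (f ∘ suc) z fz≡0
...   | y , fy≡0 , below =
  suc y , fy≡0 , λ { zero _ → w , f0 ; (suc z′) (s≤s z′<y) → below z′ z′<y }

mu-minimalZero : ∀ {n} {f : Code (suc n)} {F xs y} → Computes f F →
                 Eval (mu f) xs y → MinimalZero (λ z → F (z ∷ xs)) y
mu-minimalZero f-correct (ev-mu zero-at below) =
  Eval-deterministic (f-correct _) zero-at ,
  λ z z<y → proj₁ (below z z<y) , Eval-deterministic (f-correct _) (proj₂ (below z z<y))

mu-converges : ∀ {n} {f : Code (suc n)} {F xs} z → Computes f F →
               F (z ∷ xs) ≡ 0 → Σ ℕ (Eval (mu f) xs)
mu-converges {f = f} z f-correct Fz≡0 with minimalZero _ z Fz≡0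
... | y , Fy≡0 , below =
  y , ev-mu (subst (Eval f _) Fy≡0 (f-correct _))
            (λ z′ z′<y → proj₁ (below z′ z′<y) , subst (Eval f _) (proj₂ (below z′ z′<y)) (f-correct _))

MinimalZero-cong : ∀ {f g : ℕ → ℕ} {y} → (∀ z → f z ≡ g z) → MinimalZero f y → MinimalZero g y
MinimalZero-cong f≗g (fy≡0 , below) =
  trans (sym (f≗g _)) fy≡0 , λ z z<y → proj₁ (below z z<y) , trans (sym (f≗g z)) (proj₂ (below z z<y))

constC : ∀ {n} → ℕ → Code n
constC zero = zer
constC (suc m) = comp succ (constC m ∷ [])

constC-correct : ∀ {n} m → Computes (constC {n} m) (λ _ → m)
constC-correct zero = zer-correct
constC-correct (suc m) = compose₁ succ-correct (constC-correct m)

addC : Code 2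
addC = prim arg₀ (comp succ (arg₁ ∷ []))

addC-correct : Computes addC (λ { (m ∷ n ∷ []) → m + n })
addC-correct = prim-computes _ proj-correct (compose₁ succ-correct proj-correct)
  (λ { (n ∷ []) → refl }) (λ { m (n ∷ []) → refl })

predC : Code 1
predC = prim zer arg₀

predC-correct : Computes predC (λ { (n ∷ []) → pred n })
predC-correct = prim-computes _ zer-correct proj-correct (λ { [] → refl }) (λ { n [] → refl })

-- the recursion runs on the first argument, so the subtrahend comes first
monusC : Code 2
monusC = prim arg₀ (comp predC (arg₁ ∷ []))

monusC-correct : Computes monusC (λ { (n ∷ m ∷ []) → m ∸ n })
monusC-correct = prim-computes _ proj-correct (compose₁ predC-correct proj-correct)
  (λ { (m ∷ []) → refl }) (λ { n (m ∷ []) → sym (pred[m∸n]≡m∸[1+n] m n) })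

∣m-n∣≡n∸m+m∸n : ∀ m n → ∣ m - n ∣ ≡ (n ∸ m) + (m ∸ n)
∣m-n∣≡n∸m+m∸n m n with ≤-total m n
... | inj₁ m≤n =
  trans (m≤n⇒∣m-n∣≡n∸m m≤n) (sym (trans (cong ((n ∸ m) +_) (m≤n⇒m∸n≡0 m≤n)) (+-identityʳ _)))
... | inj₂ n≤m = trans (m≤n⇒∣n-m∣≡n∸m n≤m) (cong (_+ (m ∸ n)) (sym (m≤n⇒m∸n≡0 n≤m)))

distC : Code 2
distC = comp addC (monusC ∷ comp monusC (arg₁ ∷ arg₀ ∷ []) ∷ [])

distC-correct : Computes distC (λ { (m ∷ n ∷ []) → ∣ m - n ∣ })
distC-correct (m ∷ n ∷ []) =
  subst (Eval distC _) (sym (∣m-n∣≡n∸m+m∸n m n))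
    (compose₂ addC-correct monusC-correct (compose₂ monusC-correct proj-correct proj-correct) (m ∷ n ∷ []))

-- Bit strings and their codes

headBit : Str → ℕ
headBit [] = 0
headBit (false ∷ _) = 0
headBit (true ∷ _) = 1

#₁-++ : ∀ σ τ → #₁ (σ ++ τ) ≡ #₁ σ + #₁ τ
#₁-++ [] τ = refl
#₁-++ (false ∷ σ) τ = #₁-++ σ τ
#₁-++ (true ∷ σ) τ = cong suc (#₁-++ σ τ)

#₀-++ : ∀ σ τ → #₀ (σ ++ τ) ≡ #₀ σ + #₀ τ
#₀-++ [] τ = refl
#₀-++ (false ∷ σ) τ = cong suc (#₀-++ σ τ)
#₀-++ (true ∷ σ) τ = #₀-++ σ τ

#₁-replicate-false : ∀ r σ → #₁ (replicate r false ++ σ) ≡ #₁ σ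
#₁-replicate-false zero σ = refl
#₁-replicate-false (suc r) σ = #₁-replicate-false r σ

#₀-replicate-false : ∀ r → #₀ (replicate r false) ≡ r
#₀-replicate-false zero = refl
#₀-replicate-false (suc r) = cong suc (#₀-replicate-false r)

replicate-∷ʳ : ∀ {A : Set} r (x : A) → replicate r x ∷ʳ x ≡ replicate (suc r) x
replicate-∷ʳ zero x = refl
replicate-∷ʳ (suc r) x = cong (x ∷_) (replicate-∷ʳ r x)

take-length-++ : ∀ (σ τ : Str) → take (length σ) (σ ++ τ) ≡ σ
take-length-++ [] τ = refl
take-length-++ (b ∷ σ) τ = cong (b ∷_) (take-length-++ σ τ)

drop-length-++ : ∀ (σ τ : Str) → drop (length σ) (σ ++ τ) ≡ τ
drop-length-++ [] τ = refl
drop-length-++ (b ∷ σ) τ = drop-length-++ σ τ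

#₁-take-suc : ∀ t s → #₁ (take (suc t) s) ≡ #₁ (take t s) + headBit (drop t s)
#₁-take-suc zero [] = refl
#₁-take-suc zero (false ∷ s) = refl
#₁-take-suc zero (true ∷ s) = refl
#₁-take-suc (suc t) [] = refl
#₁-take-suc (suc t) (false ∷ s) = #₁-take-suc t s
#₁-take-suc (suc t) (true ∷ s) = cong suc (#₁-take-suc t s)

parity : ℕ → ℕ
parity zero = 0
parity (suc n) = 1 ∸ parity n

half : ℕ → ℕ
half zero = 0
half (suc n) = half n + parity n

-- On a code `enc s`, `bit` reads off the first bit of s and `shift` drops it.
bit : ℕ → ℕ
bit zero = 0
bit (suc n) = parity n

shift : ℕ → ℕ
shift zero = 0
shift (suc n) = half n

shifts : ℕ → ℕ → ℕ
shifts zero x = x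
shifts (suc i) x = shift (shifts i x)

ones : ℕ → ℕ → ℕ
ones zero x = 0
ones (suc t) x = ones t x + bit (shifts t x)

notC : Code 1
notC = comp monusC (arg₀ ∷ constC 1 ∷ [])

notC-correct : Computes notC (λ { (n ∷ []) → 1 ∸ n })
notC-correct (n ∷ []) = compose₂ monusC-correct proj-correct (constC-correct 1) (n ∷ [])

parityC : Code 1
parityC = prim zer (comp notC (arg₁ ∷ []))

parityC-correct : Computes parityC (λ { (n ∷ []) → parity n })
parityC-correct = prim-computes _ zer-correct (compose₁ notC-correct proj-correct)
  (λ { [] → refl }) (λ { n [] → refl })

halfC : Code 1
halfC = prim zer (comp addC (arg₁ ∷ comp parityC (arg₀ ∷ []) ∷ []))

halfC-correct : Computes halfC (λ { (n ∷ []) → half n })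
halfC-correct = prim-computes _ zer-correct
  (compose₂ addC-correct proj-correct (compose₁ parityC-correct proj-correct))
  (λ { [] → refl }) (λ { n [] → refl })

bitC : Code 1
bitC = prim zer (comp parityC (arg₀ ∷ []))

bitC-correct : Computes bitC (λ { (n ∷ []) → bit n })
bitC-correct = prim-computes _ zer-correct (compose₁ parityC-correct proj-correct)
  (λ { [] → refl }) (λ { n [] → refl })

shiftC : Code 1
shiftC = prim zer (comp halfC (arg₀ ∷ []))

shiftC-correct : Computes shiftC (λ { (n ∷ []) → shift n })
shiftC-correct = prim-computes _ zer-correct (compose₁ halfC-correct proj-correct)
  (λ { [] → refl }) (λ { n [] → refl })

shiftsC : Code 2
shiftsC = prim arg₀ (comp shiftC (arg₁ ∷ []))

shiftsC-correct : Computes shiftsC (λ { (i ∷ x ∷ []) → shifts i x })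
shiftsC-correct = prim-computes _ proj-correct (compose₁ shiftC-correct proj-correct)
  (λ { (x ∷ []) → refl }) (λ { i (x ∷ []) → refl })

onesC : Code 2
onesC = prim zer (comp addC (arg₁ ∷ comp bitC (comp shiftsC (arg₀ ∷ arg₂ ∷ []) ∷ []) ∷ []))

onesC-correct : Computes onesC (λ { (t ∷ x ∷ []) → ones t x })
onesC-correct = prim-computes _ zer-correct
  (compose₂ addC-correct proj-correct
    (compose₁ bitC-correct (compose₂ shiftsC-correct proj-correct proj-correct)))
  (λ { (x ∷ []) → refl }) (λ { t (x ∷ []) → refl })

2*n≡n+n : ∀ n → 2 * n ≡ n + n
2*n≡n+n n = cong (n +_) (+-identityʳ n)

parity-double : ∀ n → parity (n + n) ≡ 0
parity-double zero = refl
parity-double (suc n) rewrite +-suc n n | parity-double n = refl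

half-double : ∀ n → half (n + n) ≡ n
half-double zero = refl
half-double (suc n) rewrite +-suc n n | parity-double n | half-double n | +-identityʳ n = +-comm n 1

shift-enc : ∀ s → shift (enc s) ≡ enc (drop 1 s)
shift-enc [] = refl
shift-enc (false ∷ s) rewrite 2*n≡n+n (enc s) = half-double (enc s)
shift-enc (true ∷ s) rewrite 2*n≡n+n (enc s) | parity-double (enc s) =
  trans (+-identityʳ _) (half-double (enc s))

bit-enc : ∀ s → bit (enc s) ≡ headBit s
bit-enc [] = refl
bit-enc (false ∷ s) rewrite 2*n≡n+n (enc s) = parity-double (enc s)
bit-enc (true ∷ s) rewrite 2*n≡n+n (enc s) | parity-double (enc s) = refl

shifts-enc : ∀ i s → shifts i (enc s) ≡ enc (drop i s)
shifts-enc zero s = refl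
shifts-enc (suc i) s = begin
  shift (shifts i (enc s))  ≡⟨ cong shift (shifts-enc i s) ⟩
  shift (enc (drop i s))    ≡⟨ shift-enc (drop i s) ⟩
  enc (drop 1 (drop i s))   ≡⟨ cong enc (drop-drop i 1 s) ⟩
  enc (drop (i + 1) s)      ≡⟨ cong (λ n → enc (drop n s)) (+-comm i 1) ⟩
  enc (drop (suc i) s)      ∎
  where open ≡-Reasoning

ones-enc : ∀ t s → ones t (enc s) ≡ #₁ (take t s)
ones-enc zero s = refl
ones-enc (suc t) s = begin
  ones t (enc s) + bit (shifts t (enc s))  ≡⟨ cong₂ _+_ (ones-enc t s) (cong bit (shifts-enc t s)) ⟩
  #₁ (take t s) + bit (enc (drop t s))     ≡⟨ cong (#₁ (take t s) +_) (bit-enc (drop t s)) ⟩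
  #₁ (take t s) + headBit (drop t s)       ≡⟨ #₁-take-suc t s ⟨
  #₁ (take (suc t) s)                      ∎
  where open ≡-Reasoning

enc≡0⇒[] : ∀ s → enc s ≡ 0 → s ≡ []
enc≡0⇒[] [] _ = refl
enc≡0⇒[] (false ∷ s) ()
enc≡0⇒[] (true ∷ s) ()

enc≡enc[true]⇒≡[true] : ∀ s → enc s ≡ enc (true ∷ []) → s ≡ true ∷ []
enc≡enc[true]⇒≡[true] s eq =
  first-and-last s (trans (sym (bit-enc s)) (cong bit eq))
                   (enc≡0⇒[] (drop 1 s) (trans (sym (shift-enc s)) (cong shift eq)))
  where
  first-and-last : ∀ s → headBit s ≡ 1 → drop 1 s ≡ [] → s ≡ true ∷ []
  first-and-last (true ∷ []) _ _ = refl

consC : Bool → Code 1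
consC false = comp succ (comp addC (arg₀ ∷ arg₀ ∷ []) ∷ [])
consC true = comp succ (consC false ∷ [])

consC-correct : ∀ b s → Eval (consC b) (enc s ∷ []) (enc (b ∷ s))
consC-correct false s rewrite 2*n≡n+n (enc s) =
  compose₁ succ-correct (compose₂ addC-correct proj-correct proj-correct) (enc s ∷ [])
consC-correct true s = ev-comp (ev-∷ (consC-correct false s) ev-[]) ev-succ

prependC : Str → Code 1
prependC [] = arg₀
prependC (b ∷ σ) = comp (consC b) (prependC σ ∷ [])

prependC-correct : ∀ σ s → Eval (prependC σ) (enc s ∷ []) (enc (σ ++ s))
prependC-correct [] s = ev-proj
prependC-correct (b ∷ σ) s = ev-comp (ev-∷ (prependC-correct σ s) ev-[]) (consC-correct b (σ ++ s))

doubleZerosC : Code 1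
doubleZerosC = prim zer (comp (consC false) (comp (consC false) (arg₁ ∷ []) ∷ []))

doubleZerosC-correct : ∀ h → Eval doubleZerosC (h ∷ []) (enc (replicate (h + h) false))
doubleZerosC-correct zero = ev-prim0 ev-zer
doubleZerosC-correct (suc h) rewrite +-suc h h =
  ev-primS (doubleZerosC-correct h)
    (ev-comp (ev-∷ (ev-comp (ev-∷ ev-proj ev-[]) (consC-correct false zeros)) ev-[])
             (consC-correct false (false ∷ zeros)))
  where zeros = replicate (h + h) false

-- Self-delimiting headers

unary : ℕ → Str → Str
unary h π = replicate h false ++ true ∷ π

Header : ℕ → Str → Set
Header h σ = Σ Str λ π → σ ≡ unary h π

unary-injective : ∀ h h′ {π π′} → unary h π ≡ unary h′ π′ → h ≡ h′ × π ≡ π′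
unary-injective zero zero eq = refl , ∷-injectiveʳ eq
unary-injective (suc h) (suc h′) eq with unary-injective h h′ (∷-injectiveʳ eq)
... | refl , π≡π′ = refl , π≡π′

unary-++ : ∀ h π ρ → unary h π ++ ρ ≡ unary h (π ++ ρ)
unary-++ h π ρ = ++-assoc (replicate h false) (true ∷ π) ρ

Header-++ : ∀ {h h′ σ ρ} → Header h σ → Header h′ (σ ++ ρ) → h ≡ h′
Header-++ {h} {h′} {ρ = ρ} (π , refl) (π′ , eq) =
  proj₁ (unary-injective h h′ (trans (sym (unary-++ h π ρ)) eq))

drop-unary : ∀ h π → drop h (unary h π) ≡ true ∷ π
drop-unary zero π = refl
drop-unary (suc h) π = drop-unary h π

drop-suc-unary : ∀ h π → drop (suc h) (unary h π) ≡ π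
drop-suc-unary zero π = refl
drop-suc-unary (suc h) π = drop-suc-unary h π

header-from-bits : ∀ h σ → MinimalZero (λ z → 1 ∸ headBit (drop z σ)) h → Header h σ
header-from-bits zero (true ∷ σ) _ = σ , refl
header-from-bits (suc h) (true ∷ σ) (_ , below) with () ← proj₂ (below 0 (s≤s z≤n))
header-from-bits (suc h) (false ∷ σ) (zero-at , below)
  with π , σ≡ ← header-from-bits h σ (zero-at , λ z z<h → below (suc z) (s≤s z<h)) =
  π , cong (false ∷_) σ≡

headerTestC : Code 2
headerTestC = comp notC (comp bitC (shiftsC ∷ []) ∷ [])

-- the least z such that bit z of the input is 1
headerC : Code 1
headerC = mu headerTestC

headerTestC-correct : Computes headerTestC (λ { (z ∷ x ∷ []) → 1 ∸ bit (shifts z x) })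
headerTestC-correct (z ∷ x ∷ []) = compose₁ notC-correct (compose₁ bitC-correct shiftsC-correct) (z ∷ x ∷ [])

headerTest-enc : ∀ σ z → 1 ∸ bit (shifts z (enc σ)) ≡ 1 ∸ headBit (drop z σ)
headerTest-enc σ z = cong (1 ∸_) (trans (cong bit (shifts-enc z σ)) (bit-enc (drop z σ)))

headerTest-unary : ∀ h π → 1 ∸ bit (shifts h (enc (unary h π))) ≡ 0
headerTest-unary h π = trans (headerTest-enc (unary h π) h) (cong (λ s → 1 ∸ headBit s) (drop-unary h π))

headerC-inv : ∀ {σ h} → Eval headerC (enc σ ∷ []) h → Header h σ
headerC-inv {σ} {h} ev =
  header-from-bits h σ (MinimalZero-cong (headerTest-enc σ) (mu-minimalZero headerTestC-correct ev))

headerC-eval : ∀ {σ h} → Header h σ → Eval headerC (enc σ ∷ []) h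
-- μ stops at some y ≤ h, and headerC-inv forces y = h.
headerC-eval {h = h} (π , refl)
  with y , ev ← mu-converges h headerTestC-correct (headerTest-unary h π)
  with π′ , eq ← headerC-inv ev
  with refl , _ ← unary-injective h y eq = ev

-- On input 0ʰ1π (h found by headerC) the machine outputs `out (h , 0ʰ1π)`,
-- provided `test (s , h , 0ʰ1π)` vanishes for some s.
headerMachine : Code 3 → Code 2 → Code 1
headerMachine test out = comp (comp arg₀ (out ∷ mu test ∷ [])) (headerC ∷ arg₀ ∷ [])

module _ {test : Code 3} {G : Vec ℕ 3 → ℕ} (test-correct : Computes test G) where

  headerMachine-domain : ∀ {out σ y} → Eval (headerMachine test out) (enc σ ∷ []) y →
                         Σ ℕ λ h → Header h σ × Σ ℕ λ s → G (s ∷ h ∷ enc σ ∷ []) ≡ 0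
  headerMachine-domain (ev-comp (ev-∷ hdr (ev-∷ ev-proj ev-[])) (ev-comp (ev-∷ _ (ev-∷ search ev-[])) _)) =
    _ , headerC-inv hdr , _ , proj₁ (mu-minimalZero test-correct search)

  headerMachine-eval : ∀ {out y} σ h s → Eval out (h ∷ enc σ ∷ []) y →
                       Header h σ → G (s ∷ h ∷ enc σ ∷ []) ≡ 0 →
                       Eval (headerMachine test out) (enc σ ∷ []) y
  headerMachine-eval σ h s output header zero-at =
    ev-comp (ev-∷ (headerC-eval header) (ev-∷ ev-proj ev-[]))
            (ev-comp (ev-∷ output (ev-∷ (proj₂ (mu-converges s test-correct zero-at)) ev-[])) ev-proj)

  headerMachine-prefixFree : ∀ {out} (Q : ℕ → Str → Set) →
                             (∀ h σ s → Header h σ → G (s ∷ h ∷ enc σ ∷ []) ≡ 0 → Q h σ) →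
                             (∀ {h σ ρ} → Q h σ → Q h (σ ++ ρ) → ρ ≡ []) →
                             PrefixFree (MachineOf (headerMachine test out))
  headerMachine-prefixFree Q domain⇒Q Q-prefixFree {σ} ev ev′ (ρ , refl)
    with _ , header , _ , zero-at ← headerMachine-domain ev
       | _ , header′ , _ , zero-at′ ← headerMachine-domain ev′
    with refl ← Header-++ header header′
    with refl ← Q-prefixFree {σ = σ} {ρ = ρ} (domain⇒Q _ _ _ header zero-at)
                                              (domain⇒Q _ _ _ header′ zero-at′) =
    sym (++-identityʳ σ)

-- Machine A: 0ʰ1τ1 ↦ τ1 whenever τ1 contains exactly 2h ones

testAC : Code 3
testAC = comp addC (comp distC (comp shiftsC (arg₀ ∷ arg₂ ∷ []) ∷ constC (enc (true ∷ [])) ∷ []) ∷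
                   comp distC (comp onesC (arg₀ ∷ arg₂ ∷ []) ∷ comp addC (arg₁ ∷ arg₁ ∷ []) ∷ []) ∷ [])

testA : Vec ℕ 3 → ℕ
testA (s ∷ h ∷ x ∷ []) = ∣ shifts s x - enc (true ∷ []) ∣ + ∣ ones s x - (h + h) ∣

testAC-correct : Computes testAC testA
testAC-correct (s ∷ h ∷ x ∷ []) =
  compose₂ addC-correct
    (compose₂ distC-correct (compose₂ shiftsC-correct proj-correct proj-correct)
                            (constC-correct (enc (true ∷ []))))
    (compose₂ distC-correct (compose₂ onesC-correct proj-correct proj-correct)
                            (compose₂ addC-correct proj-correct proj-correct))
    (s ∷ h ∷ x ∷ [])

EndsInOneAfter : ℕ → Str → Set
EndsInOneAfter c σ = Σ Str λ τ → σ ≡ τ ∷ʳ true × #₁ τ ≡ c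

testA≡0⇒ : ∀ s h σ → testA (s ∷ h ∷ enc σ ∷ []) ≡ 0 → EndsInOneAfter (h + h) σ
testA≡0⇒ s h σ eq = take s σ , σ-split , count
  where
  last : drop s σ ≡ true ∷ []
  last = enc≡enc[true]⇒≡[true] (drop s σ)
           (trans (sym (shifts-enc s σ)) (∣m-n∣≡0⇒m≡n (m+n≡0⇒m≡0 _ eq)))
  σ-split : σ ≡ take s σ ∷ʳ true
  σ-split = trans (sym (take++drop≡id s σ)) (cong (take s σ ++_) last)
  count : #₁ (take s σ) ≡ h + h
  count = trans (sym (ones-enc s σ)) (∣m-n∣≡0⇒m≡n (m+n≡0⇒n≡0 ∣ shifts s (enc σ) - 2 ∣ eq))

⇒testA≡0 : ∀ {h σ} → ((τ , _) : EndsInOneAfter (h + h) σ) → testA (length τ ∷ h ∷ enc σ ∷ []) ≡ 0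
⇒testA≡0 {h} (τ , refl , count) = begin
  testA (length τ ∷ h ∷ enc (τ ∷ʳ true) ∷ [])
    ≡⟨ cong₂ (λ x y → ∣ x - 2 ∣ + ∣ y - (h + h) ∣)
             (trans (shifts-enc (length τ) (τ ∷ʳ true)) (cong enc (drop-length-++ τ _)))
             (trans (ones-enc (length τ) (τ ∷ʳ true)) (trans (cong #₁ (take-length-++ τ _)) count)) ⟩
  ∣ 2 - 2 ∣ + ∣ (h + h) - (h + h) ∣
    ≡⟨ ∣n-n∣≡0 (h + h) ⟩
  0 ∎
  where open ≡-Reasoning

EndsInOneAfter-prefixFree : ∀ {c σ ρ} → EndsInOneAfter c σ → EndsInOneAfter c (σ ++ ρ) → ρ ≡ []
EndsInOneAfter-prefixFree {ρ = ρ} _ _ with reverseView ρ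
... | [] = refl
EndsInOneAfter-prefixFree (τ , refl , count) (τ′ , eq , count′) | ρ₀ ∶ _ ∶ʳ r
  with τ′≡ , _ ← ∷ʳ-injective ((τ ∷ʳ true) ++ ρ₀) τ′ (trans (++-assoc (τ ∷ʳ true) ρ₀ (r ∷ [])) eq) =
  ⊥-elim (m+1+n≢m (#₁ τ) (begin
    #₁ τ + suc (#₁ ρ₀)       ≡⟨ #₁-++ τ (true ∷ ρ₀) ⟨
    #₁ (τ ++ true ∷ ρ₀)      ≡⟨ cong #₁ (++-assoc τ (true ∷ []) ρ₀) ⟨
    #₁ ((τ ∷ʳ true) ++ ρ₀)   ≡⟨ cong #₁ τ′≡ ⟩
    #₁ τ′                    ≡⟨ trans count′ (sym count) ⟩
    #₁ τ                     ∎))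
  where open ≡-Reasoning

outputAC : Code 2
outputAC = comp shiftsC (comp succ (arg₀ ∷ []) ∷ arg₁ ∷ [])

machineA : Code 1
machineA = headerMachine testAC outputAC

-- The outputs τ, τ′ occur only under enc, so Agda cannot infer them; they are passed on by hand.
machineA-prefixFree : PrefixFree (MachineOf machineA)
machineA-prefixFree {τ = τ} {τ′} =
  headerMachine-prefixFree testAC-correct (λ h → EndsInOneAfter (h + h)) (λ h σ s _ → testA≡0⇒ s h σ)
                           (λ {h} → EndsInOneAfter-prefixFree {h + h}) {τ = τ} {τ′}

outputAC-eval : ∀ h π → Eval outputAC (h ∷ enc (unary h π) ∷ []) (enc π)
outputAC-eval h π =
  subst (Eval outputAC _) (trans (shifts-enc (suc h) (unary h π)) (cong enc (drop-suc-unary h π)))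
        (compose₂ shiftsC-correct (compose₁ succ-correct proj-correct) proj-correct (h ∷ enc (unary h π) ∷ []))

machineA-eval : ∀ h τ → #₁ (τ ∷ʳ true) ≡ h + h → MachineOf machineA (unary h (τ ∷ʳ true)) (τ ∷ʳ true)
machineA-eval h τ count =
  headerMachine-eval testAC-correct (unary h (τ ∷ʳ true)) h (length (unary h τ))
                     (outputAC-eval h (τ ∷ʳ true)) (τ ∷ʳ true , refl)
                     (⇒testA≡0 {h} (unary h τ , sym (unary-++ h τ (true ∷ [])) , count′))
  where
  open ≡-Reasoning
  count′ : #₁ (unary h τ) ≡ h + h
  count′ = begin
    #₁ (unary h τ)    ≡⟨ #₁-replicate-false h (true ∷ τ) ⟩
    suc (#₁ τ)        ≡⟨ +-comm 1 (#₁ τ) ⟩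
    #₁ τ + 1          ≡⟨ #₁-++ τ (true ∷ []) ⟨
    #₁ (τ ∷ʳ true)    ≡⟨ count ⟩
    h + h             ∎

-- Machine B: 0ʰ1 ↦ σ0²ʰ for a fixed σ

testBC : Code 3
testBC = comp shiftsC (comp succ (arg₁ ∷ []) ∷ arg₂ ∷ [])

testB : Vec ℕ 3 → ℕ
testB (_ ∷ h ∷ x ∷ []) = shifts (suc h) x

testBC-correct : Computes testBC testB
testBC-correct (s ∷ h ∷ x ∷ []) =
  compose₂ shiftsC-correct (compose₁ succ-correct proj-correct) proj-correct (s ∷ h ∷ x ∷ [])

testB≡0⇒ : ∀ h σ s → Header h σ → testB (s ∷ h ∷ enc σ ∷ []) ≡ 0 → σ ≡ unary h []
testB≡0⇒ h _ _ (π , refl) eq =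
  cong (unary h) (enc≡0⇒[] π (begin
    enc π                             ≡⟨ cong enc (drop-suc-unary h π) ⟨
    enc (drop (suc h) (unary h π))    ≡⟨ shifts-enc (suc h) (unary h π) ⟨
    shifts (suc h) (enc (unary h π))  ≡⟨ eq ⟩
    0                                 ∎))
  where open ≡-Reasoning

outputBC : Str → Code 2
outputBC σ = comp (prependC σ) (comp doubleZerosC (arg₀ ∷ []) ∷ [])

machineB : Str → Code 1
machineB σ = headerMachine testBC (outputBC σ)

machineB-prefixFree : ∀ σ → PrefixFree (MachineOf (machineB σ))
machineB-prefixFree _ {τ = τ} {τ′} =
  headerMachine-prefixFree testBC-correct (λ h σ → σ ≡ unary h []) testB≡0⇒ unary-prefixFree {τ = τ} {τ′}
  where
  unary-prefixFree : ∀ {h σ ρ} → σ ≡ unary h [] → σ ++ ρ ≡ unary h [] → ρ ≡ []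
  unary-prefixFree {σ = σ} {ρ} refl eq = ++-cancelˡ σ ρ [] (trans eq (sym (++-identityʳ σ)))

machineB-eval : ∀ σ h → MachineOf (machineB σ) (unary h []) (σ ++ replicate (h + h) false)
machineB-eval σ h = headerMachine-eval testBC-correct (unary h []) h 0 output ([] , refl) nothing-after-header
  where
  output : Eval (outputBC σ) (h ∷ enc (unary h []) ∷ []) (enc (σ ++ replicate (h + h) false))
  output = ev-comp (ev-∷ (ev-comp (ev-∷ ev-proj ev-[]) (doubleZerosC-correct h)) ev-[])
                   (prependC-correct σ (replicate (h + h) false))
  nothing-after-header : shifts (suc h) (enc (unary h [])) ≡ 0
  nothing-after-header = trans (shifts-enc (suc h) (unary h [])) (cong enc (drop-suc-unary h []))

-- Description lengths

ℓ-unary : ∀ k h ρ → ℓ k (unary h ρ) ≡ h + (k + ℓ k ρ)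
ℓ-unary k h ρ = begin
  #₀ (unary h ρ) + k * #₁ (unary h ρ)
    ≡⟨ cong₂ (λ z o → z + k * o) (#₀-++ (replicate h false) (true ∷ ρ)) (#₁-replicate-false h (true ∷ ρ)) ⟩
  #₀ (replicate h false) + #₀ ρ + k * suc (#₁ ρ)
    ≡⟨ cong (λ z → z + #₀ ρ + k * suc (#₁ ρ)) (#₀-replicate-false h) ⟩
  h + #₀ ρ + k * suc (#₁ ρ)
    ≡⟨ rearrange h (#₀ ρ) (#₁ ρ) k ⟩
  h + (k + ℓ k ρ) ∎
  where
  open ≡-Reasoning
  rearrange : ∀ h a b k → h + a + k * suc b ≡ h + (k + (a + k * b))
  rearrange = solve-∀

ℓ-increasing : ∀ {j k} → k < j → ∀ σ → ℓ k σ + #₁ σ ≤ ℓ j σ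
ℓ-increasing {j} {k} k<j σ = begin
  ℓ k σ + #₁ σ            ≡⟨ rearrange (#₀ σ) (#₁ σ) k ⟩
  #₀ σ + suc k * #₁ σ     ≤⟨ +-monoʳ-≤ (#₀ σ) (*-monoˡ-≤ (#₁ σ) k<j) ⟩
  ℓ j σ                   ∎
  where
  open ≤-Reasoning
  rearrange : ∀ a b k → a + k * b + b ≡ a + suc k * b
  rearrange = solve-∀

zeros≤ℓ : ∀ j σ r → r ≤ ℓ j (σ ++ replicate r false)
zeros≤ℓ j σ r = begin
  r                                      ≤⟨ m≤n+m r (#₀ σ) ⟩
  #₀ σ + r                               ≡⟨ cong (#₀ σ +_) (#₀-replicate-false r) ⟨
  #₀ σ + #₀ (replicate r false)          ≡⟨ #₀-++ σ (replicate r false) ⟨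
  #₀ (σ ++ replicate r false)            ≤⟨ m≤m+n _ _ ⟩
  ℓ j (σ ++ replicate r false)           ∎
  where open ≤-Reasoning

-- The left-hand side is ℓₖ(0ᵉ1 0ᶜ1 ρ) + d for L = ℓₖ(ρ).
description-budget : ∀ e k d L → let c = suc (e + k + k + d) in
                     e + (k + (c + (k + L))) + d < L + (c + c)
description-budget e k d L = begin-strict
  e + (k + (c + (k + L))) + d   ≡⟨ rearrange e k d L c ⟩
  (L + c) + (e + k + k + d)     <⟨ +-monoʳ-< (L + c) (n<1+n (e + k + k + d)) ⟩
  (L + c) + c                   ≡⟨ +-assoc L c c ⟩
  L + (c + c)                   ∎
  where
  open ≤-Reasoning
  c = suc (e + k + k + d)
  rearrange : ∀ e k d L c → e + (k + (c + (k + L))) + d ≡ (L + c) + (e + k + k + d)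
  rearrange = solve-∀

description-threshold : ∀ {M} → PFListing M → ∀ k d (c : Code 1) → PrefixFree (MachineOf c) →
                        Σ ℕ λ h → 1 ≤ h × ∀ {ρ σ m} → K≥ M k σ d m → MachineOf c (unary h ρ) σ →
                                                        m < ℓ k ρ + (h + h)
description-threshold {M} listing k d c prefixFree
  with e , M-e≡c ← PFListing.complete listing c (λ {_ _ τ τ′} → prefixFree {τ = τ} {τ′}) =
  h , s≤s z≤n , λ {ρ} {σ} {m} K≥m c-run → begin-strict
    m                                ≤⟨ K≥m (unary e (unary h ρ)) (e , unary h ρ , refl , e-runs-c c-run) ⟩
    ℓ k (unary e (unary h ρ)) + d    ≡⟨ cong (_+ d) (ℓ-unary k e (unary h ρ)) ⟩
    e + (k + ℓ k (unary h ρ)) + d    ≡⟨ cong (λ n → e + (k + n) + d) (ℓ-unary k h ρ) ⟩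
    e + (k + (h + (k + ℓ k ρ))) + d  <⟨ description-budget e k d (ℓ k ρ) ⟩
    ℓ k ρ + (h + h)                  ∎
  where
  open ≤-Reasoning
  h = suc (e + k + k + d)
  e-runs-c : ∀ {ρ σ} → MachineOf c ρ σ → M e ρ σ
  e-runs-c = Equivalence.from (M-e≡c _ _)

EventuallyFalse : (ℕ → Bool) → Set
EventuallyFalse X = Σ ℕ λ N → ∀ n → N ≤ n → X n ≡ false

module _ (X : ℕ → Bool) where

  ↾-suc : ∀ n → X ↾ suc n ≡ X ↾ n ∷ʳ X n
  ↾-suc n = sym (applyUpTo-∷ʳ X n)

  #₁-↾-suc : ∀ n → #₁ (X ↾ suc n) ≡ #₁ (X ↾ n) + #₁ (X n ∷ [])
  #₁-↾-suc n = trans (cong #₁ (↾-suc n)) (#₁-++ (X ↾ n) (X n ∷ []))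

  #₁-↾-mono : ∀ {m n} → m ≤ n → #₁ (X ↾ m) ≤ #₁ (X ↾ n)
  #₁-↾-mono {n = zero} z≤n = ≤-refl
  #₁-↾-mono {m} {suc n} m≤1+n with m≤n⇒m<n∨m≡n m≤1+n
  ... | inj₂ refl = ≤-refl
  ... | inj₁ (s≤s m≤n) = ≤-trans (#₁-↾-mono m≤n) (≤-trans (m≤m+n _ _) (≤-reflexive (sym (#₁-↾-suc n))))

  ↾-eventuallyFalse : ∀ {N} → (∀ n → N ≤ n → X n ≡ false) → ∀ r → X ↾ (N + r) ≡ X ↾ N ++ replicate r false
  ↾-eventuallyFalse {N} zeros zero = trans (cong (X ↾_) (+-identityʳ N)) (sym (++-identityʳ _))
  ↾-eventuallyFalse {N} zeros (suc r) = begin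
    X ↾ (N + suc r)                                 ≡⟨ cong (X ↾_) (+-suc N r) ⟩
    X ↾ suc (N + r)                                 ≡⟨ ↾-suc (N + r) ⟩
    X ↾ (N + r) ∷ʳ X (N + r)                        ≡⟨ cong₂ _∷ʳ_ (↾-eventuallyFalse zeros r) (zeros (N + r) (m≤m+n N r)) ⟩
    (X ↾ N ++ replicate r false) ∷ʳ false          ≡⟨ ++-assoc (X ↾ N) (replicate r false) (false ∷ []) ⟩
    X ↾ N ++ replicate r false ∷ʳ false            ≡⟨ cong (X ↾ N ++_) (replicate-∷ʳ r false) ⟩
    X ↾ N ++ replicate (suc r) false               ∎
    where open ≡-Reasoning

  one-after : ¬ EventuallyFalse X → ∀ N → ¬ ¬ (Σ ℕ λ n → N ≤ n × X n ≡ true)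
  one-after noEv N none = noEv (N , λ n N≤n → ¬-not (λ Xn≡true → none (n , N≤n , Xn≡true)))

  #₁-↾-unbounded : ¬ EventuallyFalse X → ∀ c → ¬ ¬ (Σ ℕ λ n → c ≤ #₁ (X ↾ n))
  #₁-↾-unbounded noEv zero = pure (0 , z≤n)
    where open RawMonad (¬¬-Monad {0ℓ})
  #₁-↾-unbounded noEv (suc c) = do
    n , c≤#₁ ← #₁-↾-unbounded noEv c
    m , n≤m , Xm≡true ← one-after noEv n
    pure (suc m , (begin
      suc c                          ≤⟨ s≤s (≤-trans c≤#₁ (#₁-↾-mono n≤m)) ⟩
      suc (#₁ (X ↾ m))               ≡⟨ +-comm 1 _ ⟩
      #₁ (X ↾ m) + #₁ (true ∷ [])    ≡⟨ cong (λ b → #₁ (X ↾ m) + #₁ (b ∷ [])) Xm≡true ⟨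
      #₁ (X ↾ m) + #₁ (X m ∷ [])     ≡⟨ #₁-↾-suc m ⟨
      #₁ (X ↾ suc m)                 ∎))
    where
    open RawMonad (¬¬-Monad {0ℓ})
    open ≤-Reasoning

  #₁-↾-hits : ∀ {c} n → 1 ≤ c → c ≤ #₁ (X ↾ n) →
              Σ ℕ λ m → X ↾ suc m ≡ X ↾ m ∷ʳ true × #₁ (X ↾ m ∷ʳ true) ≡ c
  #₁-↾-hits zero 1≤c c≤0 with () ← ≤-trans 1≤c c≤0
  #₁-↾-hits {c} (suc n) 1≤c c≤#₁ with c ≤? #₁ (X ↾ n) | X n in Xn
  ... | yes c≤#₁′ | _ = #₁-↾-hits n 1≤c c≤#₁′
  ... | no c≰#₁ | true =
    n , last-one , trans count (≤-antisym (≰⇒> c≰#₁) (subst (c ≤_) (trans (cong #₁ last-one) count) c≤#₁))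
    where
    last-one : X ↾ suc n ≡ X ↾ n ∷ʳ true
    last-one = trans (↾-suc n) (cong (X ↾ n ∷ʳ_) Xn)
    count : #₁ (X ↾ n ∷ʳ true) ≡ suc (#₁ (X ↾ n))
    count = trans (#₁-++ (X ↾ n) (true ∷ [])) (+-comm _ 1)
  ... | no c≰#₁ | false = ⊥-elim (c≰#₁ (subst (c ≤_) no-new-one c≤#₁))
    where
    no-new-one : #₁ (X ↾ suc n) ≡ #₁ (X ↾ n)
    no-new-one = trans (#₁-↾-suc n) (trans (cong (λ b → #₁ (X ↾ n) + #₁ (b ∷ [])) Xn) (+-identityʳ _))

module Incompressibility {M : ℕ → Machine} (listing : PFListing M) {j k : ℕ} (k<j : k < j)
                         (X : ℕ → Bool) (d : ℕ) where

  Incompressible : Str → Set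
  Incompressible σ = K≥ M k σ d (ℓ j σ)

  module _ (incompressible : ∀ n → Incompressible (X ↾ n)) where

    eventuallyFalse-impossible : ¬ EventuallyFalse X
    eventuallyFalse-impossible (N , zeros) =
      let h , _ , threshold =
            description-threshold listing k d (machineB σ) (λ {_ _ τ τ′} → machineB-prefixFree σ {τ = τ} {τ′})
          σ0²ʰ = σ ++ replicate (h + h) false
      in ≤⇒≯ (subst (λ z → z + (h + h) ≤ ℓ j σ0²ʰ) (sym (*-zeroʳ k)) (zeros≤ℓ j σ (h + h)))
             (threshold (subst Incompressible (↾-eventuallyFalse X zeros (h + h)) (incompressible (N + (h + h))))
                        (machineB-eval σ h))
      where σ = X ↾ N

    infinitelyManyOnes-impossible : ¬ ¬ EventuallyFalse X
    infinitelyManyOnes-impossible noEv =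
      let h , 1≤h , threshold =
            description-threshold listing k d machineA (λ {_ _ τ τ′} → machineA-prefixFree {τ = τ} {τ′})
      in #₁-↾-unbounded X noEv (h + h) λ (n , 2h≤#₁) →
        let m , last-one , count = #₁-↾-hits X n (≤-trans 1≤h (m≤m+n h h)) 2h≤#₁
            π = X ↾ m ∷ʳ true
        in ≤⇒≯ (subst (λ c → ℓ k π + c ≤ ℓ j π) count (ℓ-increasing k<j π))
               (threshold (subst Incompressible last-one (incompressible (suc m))) (machineA-eval h (X ↾ m) count))

mainTheorem4 : (M : ℕ → Machine) → PFListing M → (j k : ℕ) → 1 ≤ k → k < j →
    ¬ (Σ (ℕ → Bool) λ X → Σ ℕ λ d → ∀ n → K≥ M k (X ↾ n) d (ℓ j (X ↾ n)))
mainTheorem4 M listing j k _ k<j (X , d , incompressible) =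
  infinitelyManyOnes-impossible incompressible (eventuallyFalse-impossible incompressible)
  where open Incompressibility listing k<j X d
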